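{- Let $\mathcal S$ be a spanoid on $[n]$. Then there exist a set $U$ and subsets $S_1,\dots,S_n\subseteq U$ such that for every $A\subseteq[n]$ and $i\in[n]$: $A\models i$ in $\mathcal S$ if and only if $\bigcap_{j\in A}S_j\subseteq S_i$ (where the intersection over the empty index set is $U$). In particular $\mathrm{idim}(S_1,\dots,S_n)=\mathrm{rank}(\mathcal S)$.
   Context: A spanoid $\mathcal S$ on $[n]$ is a family of pairs $(S,i)$ with $S\subseteq[n]$, $i\in[n]$ (rules). For $T\subseteq[n]$, $i\in[n]$ write $T\models i$ if there is a sequence $T=T_0,\dots,T_r$ ($r\ge0$) with $i\in T_r$ such that for each $j\in[r]$, $T_j=T_{j-1}\cup\{i_j\}$ where some $S\subseteq T_{j-1}$ has $(S,i_j)\in\mathcal S$. $\mathrm{span}(T)=\{i:T\models i\}$; $\mathrm{rank}(\mathcal S)$ is the minimum size of $T$ with $\mathrm{span}(T)=[n]$. For sets $S_1,\dots,S_n$ and $A\subseteq[n]$ let $\cap A=\bigcap_{i\in A}S_i$. The intersection-dimension $\mathrm{idim}(S_1,\dots,S_n)$ is the smallest $d$ such that some $A\subseteq[n]$ with $|A|=d$ satisfies $\cap A=\cap[n]$. -}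

module Defs where

open import Data.Nat using (ℕ; _≤_)
open import Data.Fin using (Fin)
open import Data.Fin.Subset using (Subset; _∈_; _∉_; _⊆_; _∪_; ⁅_⁆; ∣_∣)
open import Data.List using (List)
open import Data.List.Membership.Propositional renaming (_∈_ to _∈ˡ_)
open import Data.Product using (Σ; _×_; _,_; ∃)
open import Relation.Binary.PropositionalEquality using (_≡_)

Rule : ℕ → Set
Rule n = Subset n × Fin n

Spanoid : ℕ → Set
Spanoid n = List (Rule n)

data Chain {n : ℕ} (𝒮 : Spanoid n) (T : Subset n) : Subset n → Set where
  done : Chain 𝒮 T T
  step : ∀ {T' S j} → Chain 𝒮 T T' → (S , j) ∈ˡ 𝒮 → S ⊆ T' →
         Chain 𝒮 T (T' ∪ ⁅ j ⁆)

_⊨[_]_ : {n : ℕ} → Subset n → Spanoid n → Fin n → Set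
T ⊨[ 𝒮 ] i = ∃ λ T' → Chain 𝒮 T T' × i ∈ T'

Spans : {n : ℕ} → Spanoid n → Subset n → Set
Spans 𝒮 T = ∀ i → T ⊨[ 𝒮 ] i

IsRank : {n : ℕ} → Spanoid n → ℕ → Set
IsRank {n} 𝒮 d =
  (Σ (Subset n) λ T → ∣ T ∣ ≡ d × Spans 𝒮 T) ×
  (∀ (T : Subset n) → Spans 𝒮 T → d ≤ ∣ T ∣)

InterMem : {n : ℕ} {U : Set} → (Fin n → U → Set) → Subset n → U → Set
InterMem S A u = ∀ j → j ∈ A → S j u

SameInter : {n : ℕ} {U : Set} → (Fin n → U → Set) → Subset n → Subset n → Set
SameInter {U = U} S A B =
  (∀ (u : U) → InterMem S A u → InterMem S B u) ×
  (∀ (u : U) → InterMem S B u → InterMem S A u)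

IsIdim : {n : ℕ} {U : Set} → (Fin n → U → Set) → ℕ → Set
IsIdim {n} S d =
  (Σ (Subset n) λ A → ∣ A ∣ ≡ d × SameInter S A Data.Fin.Subset.⊤) ×
  (∀ (A : Subset n) → SameInter S A Data.Fin.Subset.⊤ → d ≤ ∣ A ∣)

module Submission where

-- Call C ⊆ [n] *closed* if it is stable under every rule of 𝒮
-- ((S , j) ∈ 𝒮 and S ⊆ C imply j ∈ C).  Two facts about closed sets carry
-- the whole argument:
--   * a chain started inside a closed set never leaves it;
--   * every T has a closure: a closed C reachable from T by a chain
--     (apply violated rules while one exists; each step enlarges the set).
-- Together they give  T ⊨ i  ⇔  i lies in every closed superset of T,
-- and, as a by-product, that ⊨ is decidable.
-- The representation takes U to be the set of closed sets and S_j the closed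
-- sets containing j; then ⋂_{j∈A} S_j ⊆ S_i is literally "every closed
-- superset of A contains i".  In particular ∩A = ∩[n] iff A spans, so idim
-- and rank are minima of |A| over the same (decidable, inhabited) family of
-- sets A; such a minimum exists by the least number principle.

open import Defs
open import Data.Nat using (ℕ; _≤_; _<_; _∸_; _≟_)
open import Data.Nat.Properties using (anyUpTo?; ≮⇒≥; ∸-monoʳ-<)
open import Data.Nat.Induction using (<-wellFounded)
open import Induction.WellFounded using (Acc; acc)
open import Data.Fin using (Fin)
open import Data.Fin.Subset using (Subset; _∈_; _∉_; _⊆_; _∪_; ⁅_⁆; ∣_∣; ⊤)
open import Data.Fin.Subset.Properties
  using (_∈?_; _⊆?_; ∈⊤; x∈p∪q⁻; x∈p∪q⁺; p⊆p∪q; x∈⁅x⁆; x∈⁅y⁆⇒x≡y; p⊂q⇒∣p∣<∣q∣; ∣p∣≤n; anySubset?; ∣⊤∣≡n)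
import Data.Fin.Properties as Fin
open import Data.List.Membership.Propositional using (find; lose) renaming (_∈_ to _∈ˡ_)
open import Data.List.Relation.Unary.Any using (Any; any?)
open import Data.Product using (Σ; _×_; _,_)
open import Data.Sum using (inj₁; inj₂)
open import Relation.Nullary using (Dec; yes; no; ¬_; ¬?)
open import Relation.Nullary.Decidable using (_×-dec_; map′; decidable-stable)
open import Relation.Unary using (Pred; Decidable)
open import Relation.Binary.PropositionalEquality using (_≡_; refl)
open import Function.Bundles using (_⇔_; mk⇔; Equivalence)

Least : (P : ℕ → Set) → Set
Least P = Σ ℕ λ d → P d × (∀ e → P e → d ≤ e)

least : {P : ℕ → Set} → Decidable P → ∀ {m} → P m → Least P
least {P} P? {m} = go m (<-wellFounded m)
  where
    go : ∀ m → Acc _<_ m → P m → Least P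
    go m (acc smaller) pm with anyUpTo? P? m
    ... | yes (e , e<m , pe) = go e (smaller e<m) pe
    ... | no nothing-below = m , pm , λ e pe → ≮⇒≥ (λ e<m → nothing-below (e , e<m , pe))

module _ {n : ℕ} (𝒮 : Spanoid n) where

  Closed : Subset n → Set
  Closed C = ∀ S j → (S , j) ∈ˡ 𝒮 → S ⊆ C → j ∈ C

  chain-⊆ : ∀ {T T'} → Chain 𝒮 T T' → T ⊆ T'
  chain-⊆ done x = x
  chain-⊆ (step c _ _) x = p⊆p∪q _ (chain-⊆ c x)

  chain-stays : ∀ {T T' C} → Closed C → T ⊆ C → Chain 𝒮 T T' → T' ⊆ C
  chain-stays cl T⊆C done x = T⊆C x
  chain-stays cl T⊆C (step {T'} {S} {j} c r S⊆T') x with x∈p∪q⁻ T' ⁅ j ⁆ x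
  ... | inj₁ x∈T' = chain-stays cl T⊆C c x∈T'
  ... | inj₂ x∈j rewrite x∈⁅y⁆⇒x≡y j x∈j = cl S j r (λ y → chain-stays cl T⊆C c (S⊆T' y))

  Violates : Subset n → Pred (Rule n) _
  Violates C (S , j) = S ⊆ C × j ∉ C

  violation? : ∀ C → Dec (Any (Violates C) 𝒮)
  violation? C = any? (λ { (S , j) → (S ⊆? C) ×-dec ¬? (j ∈? C) }) 𝒮

  no-violation⇒closed : ∀ {C} → ¬ Any (Violates C) 𝒮 → Closed C
  no-violation⇒closed {C} none S j r S⊆C =
    decidable-stable (j ∈? C) (λ j∉C → none (lose r (S⊆C , j∉C)))

  -- Saturation: extend a chain by violated rules until the end is closed;
  -- each step adds a new element, so n ∸ ∣X∣ strictly decreases.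
  saturate : ∀ {T X} → Chain 𝒮 T X → Acc _<_ (n ∸ ∣ X ∣) →
             Σ (Subset n) λ C → Chain 𝒮 T C × Closed C
  saturate {X = X} c (acc smaller) with violation? X
  ... | no none = X , c , no-violation⇒closed none
  ... | yes v with find v
  ...   | (S , j) , r , S⊆X , j∉X = saturate (step c r S⊆X) (smaller shrinks)
    where
      shrinks : n ∸ ∣ X ∪ ⁅ j ⁆ ∣ < n ∸ ∣ X ∣
      shrinks = ∸-monoʳ-< (p⊂q⇒∣p∣<∣q∣ (p⊆p∪q _ , j , x∈p∪q⁺ (inj₂ (x∈⁅x⁆ j)) , j∉X))
                          (∣p∣≤n (X ∪ ⁅ j ⁆))

  closure : ∀ T → Σ (Subset n) λ C → Chain 𝒮 T C × Closed C
  closure T = saturate done (<-wellFounded _)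

  ⊨⇔closed : ∀ T i → (T ⊨[ 𝒮 ] i) ⇔ (∀ C → Closed C → T ⊆ C → i ∈ C)
  ⊨⇔closed T i = mk⇔ (λ { (T' , c , i∈T') C cl T⊆C → chain-stays cl T⊆C c i∈T' })
                     (λ inAll → let C , c , cl = closure T in C , c , inAll C cl (chain-⊆ c))

  _⊨?_ : ∀ T i → Dec (T ⊨[ 𝒮 ] i)
  T ⊨? i = let C , c , cl = closure T in
    map′ (λ i∈C → C , c , i∈C) (λ T⊨i → Equivalence.to (⊨⇔closed T i) T⊨i C cl (chain-⊆ c)) (i ∈? C)

  spans? : ∀ T → Dec (Spans 𝒮 T)
  spans? T = Fin.all? (T ⊨?_)

  rank-exists : Σ ℕ (IsRank 𝒮)
  rank-exists with least {P = SpanningOfSize} spanningOfSize? {n} (⊤ , ∣⊤∣≡n n , ⊤-spans)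
    where
      SpanningOfSize : ℕ → Set
      SpanningOfSize d = Σ (Subset n) λ T → ∣ T ∣ ≡ d × Spans 𝒮 T
      spanningOfSize? : Decidable SpanningOfSize
      spanningOfSize? d = anySubset? (λ T → (∣ T ∣ ≟ d) ×-dec spans? T)
      ⊤-spans : Spans 𝒮 ⊤
      ⊤-spans i = ⊤ , done , ∈⊤
  ... | d , witness , minimal = d , witness , λ T sp → minimal ∣ T ∣ (T , refl , sp)

rank⇒idim : ∀ {n} {U : Set} {𝒮 : Spanoid n} (S : Fin n → U → Set) →
            (∀ A → Spans 𝒮 A ⇔ SameInter S A ⊤) → ∀ {d} → IsRank 𝒮 d → IsIdim S d
rank⇒idim S spans⇔same ((T , size , sp) , minimal) =
  (T , size , Equivalence.to (spans⇔same T) sp) ,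
  λ A same → minimal A (Equivalence.from (spans⇔same A) same)

mainTheorem7 : (n : ℕ) (𝒮 : Spanoid n) →
    Σ Set λ U → Σ (Fin n → U → Set) λ S →
    ((A : Subset n) (i : Fin n) →
    (A ⊨[ 𝒮 ] i) ⇔ (∀ (u : U) → InterMem S A u → S i u))
    × Σ ℕ λ d → IsIdim S d × IsRank 𝒮 d
mainTheorem7 n 𝒮 with rank-exists 𝒮
... | d , rank = Flat , S , represents , d , rank⇒idim S spans⇔same rank , rank
  where
    Flat : Set
    Flat = Σ (Subset n) (Closed 𝒮)
    S : Fin n → Flat → Set
    S j (C , _) = j ∈ C
    represents : ∀ A i → (A ⊨[ 𝒮 ] i) ⇔ (∀ u → InterMem S A u → S i u)
    represents A i = mk⇔
      (λ A⊨i (C , cl) A⊆C → Equivalence.to (⊨⇔closed 𝒮 A i) A⊨i C cl (A⊆C _))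
      (λ ⋂⊆Si → Equivalence.from (⊨⇔closed 𝒮 A i) λ C cl A⊆C → ⋂⊆Si (C , cl) (λ j → A⊆C))
    spans⇔same : ∀ A → Spans 𝒮 A ⇔ SameInter S A ⊤
    spans⇔same A = mk⇔
      (λ sp → (λ u ⋂A j _ → Equivalence.to (represents A j) (sp j) u ⋂A) , λ u ⋂⊤ j _ → ⋂⊤ j ∈⊤)
      (λ (⋂A⊆⋂⊤ , _) i → Equivalence.from (represents A i) λ u ⋂A → ⋂A⊆⋂⊤ u ⋂A i ∈⊤)
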